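{- Let $G=\Theta(s_1^{m_1}, s_2^{m_2})$ with $m_1,m_2\geq 2$. Then $\beta(G)\geq m_1+m_2-2$. Furthermore, if $W$ is a resolving set of $G$, then $W$ contains at least one internal vertex from each of $m_1-1$ distinct paths with $s_1$ internal vertices and from each of $m_2-1$ distinct paths with $s_2$ internal vertices.
   Context: Graphs are simple, connected, finite. A set $W\subseteq V(G)$ is resolving if for any distinct $u,v$ there is $w\in W$ with $d(u,w)\ne d(v,w)$; $\beta(G)$ is the minimum size of a resolving set. For positive integers $s_1<s_2$, $\Theta(s_1^{m_1},s_2^{m_2})$ is the graph consisting of two vertices $c_1,c_2$ (centers) joined by $m_1+m_2$ internally disjoint paths, exactly $m_1$ of which have $s_1$ internal vertices (length $s_1+1$) and exactly $m_2$ of which have $s_2$ internal vertices. -}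

module Defs where

open import Data.Nat using (ℕ; zero; suc; _≤_)
open import Data.Fin using (Fin; toℕ)
open import Data.Product using (Σ; _×_; ∃)
open import Data.List using (List)
open import Data.List.Membership.Propositional using (_∈_)
open import Relation.Binary.PropositionalEquality using (_≡_)
open import Relation.Nullary using (¬_)

data Walk {V : Set} (Adj : V → V → Set) : V → V → ℕ → Set where
  here : ∀ {u} → Walk Adj u u 0
  step : ∀ {u v w n} → Adj u v → Walk Adj v w n → Walk Adj u w (suc n)

IsDist : {V : Set} (Adj : V → V → Set) → V → V → ℕ → Set
IsDist Adj u v k = Walk Adj u v k × (∀ n → Walk Adj u v n → k ≤ n)

Resolving : {V : Set} (Adj : V → V → Set) → List V → Set
Resolving {V} Adj W =
  (u v : V) → ¬ (u ≡ v) →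
  Σ V λ w → w ∈ W × Σ ℕ λ k → Σ ℕ λ k' →
    IsDist Adj u w k × IsDist Adj v w k' × ¬ (k ≡ k')

-- Vertices: the two centers c₁, c₂; internal vertex number i of the
-- j-th path with s₁ internal vertices (inn₁ j i); internal vertex
-- number i of the j-th path with s₂ internal vertices (inn₂ j i).

data ThetaV (s₁ m₁ s₂ m₂ : ℕ) : Set where
  c₁ c₂ : ThetaV s₁ m₁ s₂ m₂
  inn₁  : Fin m₁ → Fin s₁ → ThetaV s₁ m₁ s₂ m₂
  inn₂  : Fin m₂ → Fin s₂ → ThetaV s₁ m₁ s₂ m₂

-- Directed edges along each path: c₁ — v₀ — v₁ — … — v_{s-1} — c₂.
data ThetaArc {s₁ m₁ s₂ m₂ : ℕ} : ThetaV s₁ m₁ s₂ m₂ → ThetaV s₁ m₁ s₂ m₂ → Set where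
  start₁ : ∀ j i → toℕ i ≡ 0 → ThetaArc c₁ (inn₁ j i)
  next₁  : ∀ j i i' → toℕ i' ≡ suc (toℕ i) → ThetaArc (inn₁ j i) (inn₁ j i')
  end₁   : ∀ j i → suc (toℕ i) ≡ s₁ → ThetaArc (inn₁ j i) c₂
  start₂ : ∀ j i → toℕ i ≡ 0 → ThetaArc c₁ (inn₂ j i)
  next₂  : ∀ j i i' → toℕ i' ≡ suc (toℕ i) → ThetaArc (inn₂ j i) (inn₂ j i')
  end₂   : ∀ j i → suc (toℕ i) ≡ s₂ → ThetaArc (inn₂ j i) c₂

data ThetaAdj {s₁ m₁ s₂ m₂ : ℕ} (u v : ThetaV s₁ m₁ s₂ m₂) : Set where
  fwd : ThetaArc u v → ThetaAdj u v
  bwd : ThetaArc v u → ThetaAdj u v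

-- Exchanging two paths of the same length is an automorphism of the theta
-- graph, and automorphisms preserve distances. If a set W avoids the interiors
-- of two paths of the same length, the exchange fixes W pointwise and swaps the
-- i-th internal vertices of the two paths, which therefore have the same
-- distance to every vertex of W. So a resolving set meets the interior of all
-- but at most one path of each length, and distinct paths give distinct
-- vertices of W.
module Submission where

open import Defs
open import Data.Nat using (ℕ; _≤_; _<_; _+_; _∸_; suc; s≤s; z≤n)
open import Data.Nat.Properties using (≤-antisym; +-suc)
open import Data.Fin using (Fin; _≟_; punchIn; splitAt)
open import Data.Fin.Patterns using (0F)
open import Data.Fin.Properties using (any?; punchIn-injective; punchInᵢ≢i; injective⇒≤; +↔⊎)
open import Data.Fin.Permutation.Components using (transpose)
open import Data.Product using (Σ; _×_; _,_; proj₁; proj₂)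
open import Data.Sum using (_⊎_; inj₁; inj₂)
open import Data.List using (List; length; tabulate)
open import Data.List.Properties using (length-tabulate)
open import Data.List.Relation.Unary.Unique.Propositional using (Unique)
open import Data.List.Relation.Unary.Unique.Propositional.Properties using (tabulate⁺)
open import Data.List.Membership.Propositional using (_∈_)
open import Data.List.Membership.Propositional.Properties using (∈-tabulate⁻)
open import Data.List.Membership.Setoid.Properties using (index-injective)
import Data.List.Membership.DecPropositional as DecMembership
open import Data.Empty using (⊥)
open import Function using (_∘_; id)
open import Function.Bundles using (Injection)
open import Function.Definitions using (Injective)
open import Function.Properties.Inverse using (↔⇒↣)
open import Relation.Nullary using (¬_; yes; no; ¬?; contradiction)
open import Relation.Nullary.Decidable using (decidable-stable)
open import Relation.Unary using (Pred; Decidable)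
open import Relation.Binary.Definitions using (DecidableEquality)
open import Relation.Binary.PropositionalEquality
  using (_≡_; _≢_; refl; sym; cong; subst; subst₂; setoid)

IsHomomorphism : {V : Set} → (V → V → Set) → (V → V) → Set
IsHomomorphism Adj f = ∀ {u v} → Adj u v → Adj (f u) (f v)

module _ {V : Set} {Adj : V → V → Set} where

  Walk-map : ∀ {f} → IsHomomorphism Adj f → ∀ {u v n} → Walk Adj u v n → Walk Adj (f u) (f v) n
  Walk-map hom here       = here
  Walk-map hom (step a p) = step (hom a) (Walk-map hom p)

  IsDist-unique : ∀ {u w k k'} → IsDist Adj u w k → IsDist Adj u w k' → k ≡ k'
  IsDist-unique (p , shortest) (p' , shortest') = ≤-antisym (shortest _ p') (shortest' _ p)

  IsDist-swap : ∀ {f} → IsHomomorphism Adj f → ∀ {u v w k} → f u ≡ v → f v ≡ u → f w ≡ w →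
    IsDist Adj u w k → IsDist Adj v w k
  IsDist-swap hom {k = k} fu≡v fv≡u fw≡w (p , shortest) =
    subst₂ (λ x y → Walk Adj x y k) fu≡v fw≡w (Walk-map hom p) ,
    λ n q → shortest n (subst₂ (λ x y → Walk Adj x y n) fv≡u fw≡w (Walk-map hom q))

  ¬Resolving-swap : ∀ {W f} → Resolving Adj W → IsHomomorphism Adj f → ∀ u v → u ≢ v →
    f u ≡ v → f v ≡ u → (∀ w → w ∈ W → f w ≡ w) → ⊥
  ¬Resolving-swap resolving hom u v u≢v fu≡v fv≡u fixes
    with resolving u v u≢v
  ... | w , w∈W , k , k' , du , dv , k≢k' =
    k≢k' (IsDist-unique (IsDist-swap hom fu≡v fv≡u (fixes w w∈W) du) dv)

transpose-matchˡ : ∀ {n} (i j : Fin n) → transpose i j i ≡ j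
transpose-matchˡ i j with i ≟ i
... | yes _   = refl
... | no i≢i = contradiction refl i≢i

transpose-matchʳ : ∀ {n} (i j : Fin n) → transpose i j j ≡ i
transpose-matchʳ i j with j ≟ i
... | yes j≡i = j≡i
... | no _ with j ≟ j
...   | yes _   = refl
...   | no j≢j = contradiction refl j≢j

transpose-mod : ∀ {n} {i j k : Fin n} → k ≢ i → k ≢ j → transpose i j k ≡ k
transpose-mod {i = i} {j} {k} k≢i k≢j with k ≟ i
... | yes k≡i = contradiction k≡i k≢i
... | no _ with k ≟ j
...   | yes k≡j = contradiction k≡j k≢j
...   | no _    = refl

transpose-fixes : ∀ {n p} {P : Pred (Fin n) p} {i j} → ¬ P i → ¬ P j →
  ∀ k → P k → transpose i j k ≡ k
transpose-fixes ¬Pi ¬Pj k Pk = transpose-mod (λ { refl → ¬Pi Pk }) (λ { refl → ¬Pj Pk })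

all-but-one : ∀ {n p} {P : Pred (Fin (suc n)) p} → Decidable P →
  (∀ i j → i ≢ j → ¬ P i → ¬ P j → ⊥) → Σ (Fin (suc n)) λ j₀ → ∀ j → j ≢ j₀ → P j
all-but-one P? atMostOneFailure with any? (¬? ∘ P?)
... | yes (j₀ , ¬Pj₀) = j₀ , λ j j≢j₀ →
  decidable-stable (P? j) (λ ¬Pj → atMostOneFailure j j₀ j≢j₀ ¬Pj ¬Pj₀)
... | no noFailure = 0F , λ j _ → decidable-stable (P? j) (λ ¬Pj → noFailure (j , ¬Pj))

allFinExcept : ∀ {n} → Fin (suc n) → List (Fin (suc n))
allFinExcept j₀ = tabulate (punchIn j₀)

allFinExcept-unique : ∀ {n} (j₀ : Fin (suc n)) → Unique (allFinExcept j₀)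
allFinExcept-unique j₀ = tabulate⁺ (punchIn-injective j₀ _ _)

length-allFinExcept : ∀ {n} (j₀ : Fin (suc n)) → length (allFinExcept j₀) ≡ n
length-allFinExcept j₀ = length-tabulate (punchIn j₀)

∈-allFinExcept⁻ : ∀ {n} {j₀ j : Fin (suc n)} → j ∈ allFinExcept j₀ → j ≢ j₀
∈-allFinExcept⁻ {j₀ = j₀} j∈ with ∈-tabulate⁻ j∈
... | x , refl = punchInᵢ≢i j₀ x

injection⇒≤length : ∀ {A : Set} {k} (W : List A) (h : Fin k → A) → Injective _≡_ _≡_ h →
  (∀ x → h x ∈ W) → k ≤ length W
injection⇒≤length W h h-injective h∈W =
  injective⇒≤ (h-injective ∘ index-injective (setoid _) (h∈W _) (h∈W _))

module _ {s₁ m₁ s₂ m₂ : ℕ} where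

  private
    V : Set
    V = ThetaV s₁ m₁ s₂ m₂

  inn₁-injectiveˡ : ∀ {j j' i i'} → _≡_ {A = V} (inn₁ j i) (inn₁ j' i') → j ≡ j'
  inn₁-injectiveˡ refl = refl

  inn₂-injectiveˡ : ∀ {j j' i i'} → _≡_ {A = V} (inn₂ j i) (inn₂ j' i') → j ≡ j'
  inn₂-injectiveˡ refl = refl

  _≟V_ : DecidableEquality V
  c₁ ≟V c₁ = yes refl
  c₂ ≟V c₂ = yes refl
  inn₁ j i ≟V inn₁ j' i' with j ≟ j' | i ≟ i'
  ... | yes refl | yes refl = yes refl
  ... | no j≢j'  | _        = no (j≢j' ∘ inn₁-injectiveˡ)
  ... | yes _    | no i≢i'  = no λ { refl → i≢i' refl }
  inn₂ j i ≟V inn₂ j' i' with j ≟ j' | i ≟ i'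
  ... | yes refl | yes refl = yes refl
  ... | no j≢j'  | _        = no (j≢j' ∘ inn₂-injectiveˡ)
  ... | yes _    | no i≢i'  = no λ { refl → i≢i' refl }
  c₁       ≟V c₂       = no λ ()
  c₁       ≟V inn₁ _ _ = no λ ()
  c₁       ≟V inn₂ _ _ = no λ ()
  c₂       ≟V c₁       = no λ ()
  c₂       ≟V inn₁ _ _ = no λ ()
  c₂       ≟V inn₂ _ _ = no λ ()
  inn₁ _ _ ≟V c₁       = no λ ()
  inn₁ _ _ ≟V c₂       = no λ ()
  inn₁ _ _ ≟V inn₂ _ _ = no λ ()
  inn₂ _ _ ≟V c₁       = no λ ()
  inn₂ _ _ ≟V c₂       = no λ ()
  inn₂ _ _ ≟V inn₁ _ _ = no λ ()

  open DecMembership _≟V_ using (_∈?_)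

  relabel : (Fin m₁ → Fin m₁) → (Fin m₂ → Fin m₂) → V → V
  relabel π₁ π₂ c₁         = c₁
  relabel π₁ π₂ c₂         = c₂
  relabel π₁ π₂ (inn₁ j i) = inn₁ (π₁ j) i
  relabel π₁ π₂ (inn₂ j i) = inn₂ (π₂ j) i

  relabel-arc : ∀ π₁ π₂ {u v} → ThetaArc u v → ThetaArc (relabel π₁ π₂ u) (relabel π₁ π₂ v)
  relabel-arc π₁ π₂ (start₁ j i i≡0)      = start₁ (π₁ j) i i≡0
  relabel-arc π₁ π₂ (next₁ j i i' i'≡1+i) = next₁ (π₁ j) i i' i'≡1+i
  relabel-arc π₁ π₂ (end₁ j i 1+i≡s)      = end₁ (π₁ j) i 1+i≡s
  relabel-arc π₁ π₂ (start₂ j i i≡0)      = start₂ (π₂ j) i i≡0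
  relabel-arc π₁ π₂ (next₂ j i i' i'≡1+i) = next₂ (π₂ j) i i' i'≡1+i
  relabel-arc π₁ π₂ (end₂ j i 1+i≡s)      = end₂ (π₂ j) i 1+i≡s

  relabel-homomorphism : ∀ π₁ π₂ → IsHomomorphism ThetaAdj (relabel π₁ π₂)
  relabel-homomorphism π₁ π₂ (fwd arc) = fwd (relabel-arc π₁ π₂ arc)
  relabel-homomorphism π₁ π₂ (bwd arc) = bwd (relabel-arc π₁ π₂ arc)

  Meets₁ : List V → Fin m₁ → Set
  Meets₁ W j = Σ (Fin s₁) λ i → inn₁ j i ∈ W

  Meets₂ : List V → Fin m₂ → Set
  Meets₂ W j = Σ (Fin s₂) λ i → inn₂ j i ∈ W

  meets₁? : ∀ W → Decidable (Meets₁ W)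
  meets₁? W j = any? λ i → inn₁ j i ∈? W

  meets₂? : ∀ W → Decidable (Meets₂ W)
  meets₂? W j = any? λ i → inn₂ j i ∈? W

  relabel-fixes : ∀ {W π₁ π₂} → (∀ j → Meets₁ W j → π₁ j ≡ j) → (∀ j → Meets₂ W j → π₂ j ≡ j) →
    ∀ w → w ∈ W → relabel π₁ π₂ w ≡ w
  relabel-fixes fixes₁ fixes₂ c₁         _   = refl
  relabel-fixes fixes₁ fixes₂ c₂         _   = refl
  relabel-fixes fixes₁ fixes₂ (inn₁ j i) w∈W = cong (λ j → inn₁ j i) (fixes₁ j (i , w∈W))
  relabel-fixes fixes₁ fixes₂ (inn₂ j i) w∈W = cong (λ j → inn₂ j i) (fixes₂ j (i , w∈W))

  ¬Resolving-avoiding₁ : ∀ {W} → Resolving ThetaAdj W → Fin s₁ →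
    ∀ a b → a ≢ b → ¬ Meets₁ W a → ¬ Meets₁ W b → ⊥
  ¬Resolving-avoiding₁ resolving i a b a≢b ¬Ma ¬Mb =
    ¬Resolving-swap resolving (relabel-homomorphism (transpose a b) id)
      (inn₁ a i) (inn₁ b i) (a≢b ∘ inn₁-injectiveˡ)
      (cong (λ j → inn₁ j i) (transpose-matchˡ a b))
      (cong (λ j → inn₁ j i) (transpose-matchʳ a b))
      (relabel-fixes (transpose-fixes ¬Ma ¬Mb) (λ _ _ → refl))

  ¬Resolving-avoiding₂ : ∀ {W} → Resolving ThetaAdj W → Fin s₂ →
    ∀ a b → a ≢ b → ¬ Meets₂ W a → ¬ Meets₂ W b → ⊥
  ¬Resolving-avoiding₂ resolving i a b a≢b ¬Ma ¬Mb =
    ¬Resolving-swap resolving (relabel-homomorphism id (transpose a b))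
      (inn₂ a i) (inn₂ b i) (a≢b ∘ inn₂-injectiveˡ)
      (cong (λ j → inn₂ j i) (transpose-matchˡ a b))
      (cong (λ j → inn₂ j i) (transpose-matchʳ a b))
      (relabel-fixes (λ _ _ → refl) (transpose-fixes ¬Ma ¬Mb))

all-but-one-list : ∀ {n p} {P : Pred (Fin (suc n)) p} →
  (Σ (Fin (suc n)) λ j₀ → ∀ j → j ≢ j₀ → P j) →
  Σ (List (Fin (suc n))) λ J → Unique J × length J ≡ n × (∀ j → j ∈ J → P j)
all-but-one-list (j₀ , P-except) =
  allFinExcept j₀ , allFinExcept-unique j₀ , length-allFinExcept j₀ ,
  λ j j∈J → P-except j (∈-allFinExcept⁻ j∈J)

module _ {s₁ n₁ s₂ n₂ : ℕ} {W : List (ThetaV s₁ (suc n₁) s₂ (suc n₂))} where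

  resolving-meets-all-but-one₁ : Resolving ThetaAdj W → Fin s₁ →
    Σ (Fin (suc n₁)) λ j₀ → ∀ j → j ≢ j₀ → Meets₁ W j
  resolving-meets-all-but-one₁ resolving i = all-but-one (meets₁? W) (¬Resolving-avoiding₁ resolving i)

  resolving-meets-all-but-one₂ : Resolving ThetaAdj W → Fin s₂ →
    Σ (Fin (suc n₂)) λ j₀ → ∀ j → j ≢ j₀ → Meets₂ W j
  resolving-meets-all-but-one₂ resolving i = all-but-one (meets₂? W) (¬Resolving-avoiding₂ resolving i)

  meets-all-but-one⇒≤length : ∀ {j₁ j₂} → (∀ j → j ≢ j₁ → Meets₁ W j) → (∀ j → j ≢ j₂ → Meets₂ W j) →
    n₁ + n₂ ≤ length W
  meets-all-but-one⇒≤length {j₁} {j₂} meets₁ meets₂ =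
    injection⇒≤length W (vertex ∘ splitAt n₁)
      (Injection.injective (↔⇒↣ +↔⊎) ∘ vertex-injective) (vertex∈W ∘ splitAt n₁)
    where
    witness₁ : (x : Fin n₁) → Meets₁ W (punchIn j₁ x)
    witness₁ x = meets₁ _ (punchInᵢ≢i j₁ x)

    witness₂ : (x : Fin n₂) → Meets₂ W (punchIn j₂ x)
    witness₂ x = meets₂ _ (punchInᵢ≢i j₂ x)

    vertex : Fin n₁ ⊎ Fin n₂ → ThetaV s₁ (suc n₁) s₂ (suc n₂)
    vertex (inj₁ x) = inn₁ (punchIn j₁ x) (proj₁ (witness₁ x))
    vertex (inj₂ x) = inn₂ (punchIn j₂ x) (proj₁ (witness₂ x))

    vertex-injective : Injective _≡_ _≡_ vertex
    vertex-injective {inj₁ x} {inj₁ y} eq = cong inj₁ (punchIn-injective j₁ x y (inn₁-injectiveˡ eq))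
    vertex-injective {inj₂ x} {inj₂ y} eq = cong inj₂ (punchIn-injective j₂ x y (inn₂-injectiveˡ eq))
    vertex-injective {inj₁ _} {inj₂ _} ()
    vertex-injective {inj₂ _} {inj₁ _} ()

    vertex∈W : ∀ z → vertex z ∈ W
    vertex∈W (inj₁ x) = proj₂ (witness₁ x)
    vertex∈W (inj₂ x) = proj₂ (witness₂ x)

mainTheorem5 : (s₁ m₁ s₂ m₂ : ℕ) → 1 ≤ s₁ → s₁ < s₂ → 2 ≤ m₁ → 2 ≤ m₂ →
    ((W : List (ThetaV s₁ m₁ s₂ m₂)) → Unique W →
      Resolving (ThetaAdj {s₁} {m₁} {s₂} {m₂}) W →
      m₁ + m₂ ∸ 2 ≤ length W)
    × ((W : List (ThetaV s₁ m₁ s₂ m₂)) →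
      Resolving (ThetaAdj {s₁} {m₁} {s₂} {m₂}) W →
      (Σ (List (Fin m₁)) λ J₁ → Unique J₁ × length J₁ ≡ m₁ ∸ 1 ×
         ((j : Fin m₁) → j ∈ J₁ → Σ (Fin s₁) λ i → inn₁ j i ∈ W))
      × (Σ (List (Fin m₂)) λ J₂ → Unique J₂ × length J₂ ≡ m₂ ∸ 1 ×
         ((j : Fin m₂) → j ∈ J₂ → Σ (Fin s₂) λ i → inn₂ j i ∈ W)))
-- From s₁ < s₂ only s₂ ≥ 1 is used: each swap needs an internal vertex 0F on the swapped paths.
mainTheorem5 (suc s₁) (suc (suc n₁)) (suc s₂) (suc (suc n₂))
             (s≤s z≤n) (s≤s _) (s≤s (s≤s z≤n)) (s≤s (s≤s z≤n)) =
  (λ W _ resolving →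
    subst (_≤ length W) (sym (+-suc n₁ (suc n₂)))
      (meets-all-but-one⇒≤length (proj₂ (resolving-meets-all-but-one₁ resolving 0F))
                                 (proj₂ (resolving-meets-all-but-one₂ resolving 0F)))) ,
  (λ W resolving →
    all-but-one-list (resolving-meets-all-but-one₁ resolving 0F) ,
    all-but-one-list (resolving-meets-all-but-one₂ resolving 0F))
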